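{- Let $F_0=(V,E_0)$ be a forest (an undirected graph without cycles) with $n=|V|$ nodes and $m=|E_0|$ edges, let $p$ be an integer with $1\le p\le n-1$, and let $l$ be a positive integer. Let $F_i=(V,E_i)$, $1\le i\le l$, be a sequence of forests such that $E_i\subseteq E_{i-1}$ and $|E_i|=|E_{i-1}|-p$ for $1\le i\le l$, and such that every tree (connected component) of $F_l$ has fewer than $p$ edges. If $m>\frac{n(p-1)}{p}$, then: (1) $F_0$ contains a tree with at least $p$ edges; (2) every forest $F_i$ ($0\le i\le l$) with $i<\frac{1}{p}\left(m-\frac{n(p-1)}{p}\right)$ contains a tree with at least $p$ edges; (3) $l\ \ge\ \left\lceil \frac{1}{p}\left(m-\frac{n(p-1)}{p}\right)\right\rceil$.
   Context: Trees of a forest are its connected components; the number of edges of a tree is counted in the usual way. -}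

module Defs where

open import Data.Nat using (ℕ; zero; suc; _+_; _≤_; _<_)
open import Data.Nat.DivMod using (_/_)
open import Data.Fin using (Fin)
import Data.Fin as Fin
open import Data.Product using (_×_; _,_; proj₁; ∃; ∃-syntax)
open import Data.Sum using (_⊎_)
open import Data.List using (List; []; _∷_; _++_; length; [_])
open import Data.List.Membership.Propositional using (_∈_)
open import Data.List.Relation.Binary.Subset.Propositional using (_⊆_)
open import Data.List.Relation.Unary.All using (All)
open import Data.List.Relation.Unary.Unique.Propositional using (Unique)
open import Data.List.Relation.Unary.Linked using (Linked)
open import Relation.Binary.Construct.Closure.ReflexiveTransitive using (Star)
open import Relation.Nullary using (¬_)

-- An undirected edge on vertex set Fin n, stored as an ordered pair (u , v) with u < v.
Edge : ℕ → Set
Edge n = Fin n × Fin n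

SimpleEdges : ∀ {n} → List (Edge n) → Set
SimpleEdges E = All (λ e → proj₁ e Fin.< Data.Product.proj₂ e) E × Unique E

Adj : ∀ {n} → List (Edge n) → Fin n → Fin n → Set
Adj E u v = (u , v) ∈ E ⊎ (v , u) ∈ E

Cycle : ∀ {n} → List (Edge n) → Set
Cycle {n} E = ∃[ v ] ∃[ vs ] (Unique (v ∷ vs) × 3 ≤ length (v ∷ vs)
                × Linked (Adj E) ((v ∷ vs) ++ [ v ]))

Forest : ∀ {n} → List (Edge n) → Set
Forest E = SimpleEdges E × ¬ Cycle E

Reach : ∀ {n} → List (Edge n) → Fin n → Fin n → Set
Reach E = Star (Adj E)

InComponentOf : ∀ {n} → List (Edge n) → Fin n → Edge n → Set
InComponentOf E v e = Reach E v (proj₁ e)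

HasTreeWithAtLeast : ∀ {n} → ℕ → List (Edge n) → Set
HasTreeWithAtLeast p E = ∃[ v ] ∃[ L ] (Unique L × L ⊆ E × All (InComponentOf E v) L × p ≤ length L)

-- ceiling of a / d (d > 0); ceilDiv a 0 = 0 is a junk value never used
ceilDiv : ℕ → ℕ → ℕ
ceilDiv a zero = 0
ceilDiv a (suc k) = (a + k) / suc k

-- Label every vertex so that equal labels imply the same component, building the labelling
-- edge by edge: an edge of a forest joins two different label classes, which are merged.
-- Every non-empty class then has fewer edges than vertices.  If no class carries p edges,
-- a class with c ≤ p - 1 edges and v > c vertices satisfies p c ≤ (p - 1)(c + 1) ≤ (p - 1) v,
-- and summing over the classes gives m' p ≤ n (p - 1) for a forest with m' edges.  Since
-- F_i has m - i p edges, this bound fails for F_i as long as i p² + n (p - 1) < m p,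
-- and it holds for F_l, which gives the lower bound on l.
module Submission where

open import Defs
open import Algebra.Properties.CommutativeSemigroup using (interchange)
open import Data.Bool using (true; false; if_then_else_)
open import Data.Empty using (⊥-elim)
open import Data.Fin using (Fin; zero; suc)
import Data.Fin.Properties as FinP
open import Data.List using (List; []; _∷_; _++_; length; [_]; filter; allFin)
import Data.List.Membership.DecPropositional as DecMembership
open import Data.List.Membership.Propositional using (_∈_)
open import Data.List.Membership.Propositional.Properties using (∈-allFin; ∈-filter⁻)
open import Data.List.Properties using (length-tabulate)
open import Data.List.Relation.Binary.Subset.Propositional using (_⊆_)
open import Data.List.Relation.Binary.Subset.Propositional.Properties using (xs⊆x∷xs)
open import Data.List.Relation.Unary.All using (All; []; _∷_)
import Data.List.Relation.Unary.All as All
open import Data.List.Relation.Unary.All.Properties using (¬Any⇒All¬; all-filter)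
open import Data.List.Relation.Unary.Any using (here; there)
open import Data.List.Relation.Unary.AllPairs using ([]; _∷_)
open import Data.List.Relation.Unary.Linked using (Linked; [-]; _∷_)
import Data.List.Relation.Unary.Linked as Linked
open import Data.List.Relation.Unary.Unique.Propositional using (Unique)
import Data.List.Relation.Unary.Unique.Propositional.Properties as Unique
open import Data.Nat using (ℕ; zero; suc; _+_; _*_; _∸_; _≤_; _<_; _≥_; z≤n; s≤s)
open import Data.Nat.DivMod using (m<n*o⇒m/o<n)
open import Data.Nat.Properties hiding (_≟_)
open import Algebra.Properties.Semiring.Sum +-*-semiring
  using (sum; sum-syntax; sum-cong-≗; sum-replicate-zero; ∑-distrib-+; *-distribˡ-sum)
open import Data.Product using (_×_; _,_; proj₁; proj₂; ∃)
open import Data.Sum using (_⊎_; inj₁; inj₂; [_,_]′)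
import Data.Sum as Sum
open import Function using (id; _∘_)
open import Relation.Binary.Construct.Closure.ReflexiveTransitive using (ε; _◅_; _◅◅_)
import Relation.Binary.Construct.Closure.ReflexiveTransitive as Star
open import Relation.Binary.Definitions using (DecidableEquality)
open import Relation.Binary.PropositionalEquality hiding ([_])
open import Relation.Nullary using (¬_; yes; no; does; contradiction)
open import Relation.Nullary.Decidable using (dec-true; dec-false; toSum)

private
  variable
    A X : Set
    n : ℕ

open FinP using (_≟_)

δ : Fin n → Fin n → ℕ
δ y r = if does (y ≟ r) then 1 else 0

δ-refl : (y : Fin n) → δ y y ≡ 1
δ-refl y rewrite dec-true (y ≟ y) refl = refl

δ-≢ : {y r : Fin n} → y ≢ r → δ y r ≡ 0
δ-≢ {y = y} {r} y≢r rewrite dec-false (y ≟ r) y≢r = refl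

∑-δ : (y : Fin n) → ∑[ r < n ] δ y r ≡ 1
∑-δ {suc n} zero    = cong suc (sum-replicate-zero n)
∑-δ {suc n} (suc y) = ∑-δ y

count : (X → Fin n) → Fin n → List X → ℕ
count h r xs = length (filter (λ x → h x ≟ r) xs)

count-∷ : (h : X → Fin n) (r : Fin n) (x : X) (xs : List X) →
          count h r (x ∷ xs) ≡ δ (h x) r + count h r xs
count-∷ h r x xs with does (h x ≟ r)
... | true  = refl
... | false = refl

count-∈ : (h : X → Fin n) {x : X} {xs : List X} → x ∈ xs → 0 < count h (h x) xs
count-∈ h {xs = y ∷ xs} (here refl) rewrite count-∷ h (h y) y xs | δ-refl (h y) = s≤s z≤n
count-∈ h {x} {y ∷ xs} (there x∈xs) rewrite count-∷ h (h x) y xs =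
  ≤-trans (count-∈ h x∈xs) (m≤n+m _ _)

∑-count : (h : X → Fin n) (xs : List X) → ∑[ r < n ] count h r xs ≡ length xs
∑-count {n = n} h [] = sum-replicate-zero n
∑-count h (x ∷ xs) = begin
  ∑[ r < _ ] count h r (x ∷ xs)                   ≡⟨ sum-cong-≗ (λ r → count-∷ h r x xs) ⟩
  ∑[ r < _ ] (δ (h x) r + count h r xs)            ≡⟨ ∑-distrib-+ (δ (h x)) (λ r → count h r xs) ⟩
  ∑[ r < _ ] δ (h x) r + ∑[ r < _ ] count h r xs   ≡⟨ cong₂ _+_ (∑-δ (h x)) (∑-count h xs) ⟩
  suc (length xs)                                  ∎
  where open ≡-Reasoning

∑-mono-≤ : {f g : Fin n → ℕ} → (∀ r → f r ≤ g r) → sum f ≤ sum g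
∑-mono-≤ {zero}  f≤g = z≤n
∑-mono-≤ {suc n} f≤g = +-mono-≤ (f≤g zero) (∑-mono-≤ (f≤g ∘ suc))

merge : Fin n → Fin n → Fin n → Fin n
merge a b y = if does (y ≟ b) then a else y

module _ {a b : Fin n} where

  merge-≢ : {y : Fin n} → y ≢ b → merge a b y ≡ y
  merge-≢ {y} y≢b rewrite dec-false (y ≟ b) y≢b = refl

  merge-≡ : {x y : Fin n} → merge a b x ≡ merge a b y →
            x ≡ y ⊎ (x ≡ a × y ≡ b) ⊎ (x ≡ b × y ≡ a)
  merge-≡ {x} {y} eq with x ≟ b | y ≟ b
  ... | yes x≡b | yes y≡b = inj₁ (trans x≡b (sym y≡b))
  ... | yes refl | no _ = inj₂ (inj₂ (refl , sym eq))
  ... | no _ | yes refl = inj₂ (inj₁ (eq , refl))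
  ... | no _ | no _ = inj₁ eq

  module _ (a≢b : a ≢ b) where

    δ-merge-a : (y : Fin n) → δ (merge a b y) a ≡ δ y a + δ y b
    δ-merge-a y with y ≟ b
    ... | yes refl rewrite δ-refl a | δ-≢ (a≢b ∘ sym) = refl
    ... | no _ = sym (+-identityʳ _)

    δ-merge-b : (y : Fin n) → δ (merge a b y) b ≡ 0
    δ-merge-b y with y ≟ b
    ... | yes refl = δ-≢ a≢b
    ... | no y≢b = δ-≢ y≢b

    δ-merge-other : {r : Fin n} → r ≢ a → r ≢ b → (y : Fin n) → δ (merge a b y) r ≡ δ y r
    δ-merge-other r≢a r≢b y with y ≟ b
    ... | yes refl = trans (δ-≢ (r≢a ∘ sym)) (sym (δ-≢ (r≢b ∘ sym)))
    ... | no _ = refl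

    count-merge-a : (h : X → Fin n) (xs : List X) →
                    count (merge a b ∘ h) a xs ≡ count h a xs + count h b xs
    count-merge-a h []       = refl
    count-merge-a h (x ∷ xs) = begin
      count (merge a b ∘ h) a (x ∷ xs)
        ≡⟨ count-∷ (merge a b ∘ h) a x xs ⟩
      δ (merge a b (h x)) a + count (merge a b ∘ h) a xs
        ≡⟨ cong₂ _+_ (δ-merge-a (h x)) (count-merge-a h xs) ⟩
      (δ (h x) a + δ (h x) b) + (count h a xs + count h b xs)
        ≡⟨ interchange +-commutativeSemigroup (δ (h x) a) (δ (h x) b) (count h a xs) (count h b xs) ⟩
      (δ (h x) a + count h a xs) + (δ (h x) b + count h b xs)
        ≡⟨ cong₂ _+_ (count-∷ h a x xs) (count-∷ h b x xs) ⟨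
      count h a (x ∷ xs) + count h b (x ∷ xs)
        ∎
      where open ≡-Reasoning

    count-merge-b : (h : X → Fin n) (xs : List X) → count (merge a b ∘ h) b xs ≡ 0
    count-merge-b h []       = refl
    count-merge-b h (x ∷ xs)
      rewrite count-∷ (merge a b ∘ h) b x xs | δ-merge-b (h x) = count-merge-b h xs

    count-merge-other : {r : Fin n} → r ≢ a → r ≢ b → (h : X → Fin n) (xs : List X) →
                        count (merge a b ∘ h) r xs ≡ count h r xs
    count-merge-other r≢a r≢b h []       = refl
    count-merge-other {r = r} r≢a r≢b h (x ∷ xs)
      rewrite count-∷ (merge a b ∘ h) r x xs | count-∷ h r x xs
            | δ-merge-other r≢a r≢b (h x) | count-merge-other r≢a r≢b h xs = refl

module _ {E E′ : List (Edge n)} (E⊆E′ : E ⊆ E′) where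

  Adj-mono : ∀ {u v} → Adj E u v → Adj E′ u v
  Adj-mono = Sum.map E⊆E′ E⊆E′

  Reach-mono : ∀ {u v} → Reach E u v → Reach E′ u v
  Reach-mono = Star.map Adj-mono

  Cycle-mono : Cycle E → Cycle E′
  Cycle-mono (v , vs , unique , long , linked) = v , vs , unique , long , Linked.map Adj-mono linked

data Path (R : A → A → Set) : A → A → List A → Set where
  end  : ∀ {x} → Path R x x [ x ]
  step : ∀ {x y z vs} → R x y → Path R y z vs → Path R x z (x ∷ vs)

module _ {R : A → A → Set} where

  Path-nonempty : ∀ {x z vs} → Path R x z vs → 0 < length vs
  Path-nonempty end        = s≤s z≤n
  Path-nonempty (step _ _) = s≤s z≤n

  Path-suffix : ∀ {x y z vs} → Path R x z vs → Unique vs → y ∈ vs →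
                ∃ λ ws → Path R y z ws × Unique ws
  Path-suffix end             unique       (here refl) = _ , end , unique
  Path-suffix path@(step _ _) unique       (here refl) = _ , path , unique
  Path-suffix (step _ path)   (_ ∷ unique) (there y∈vs) = Path-suffix path unique y∈vs

  Star⇒simplePath : DecidableEquality A → ∀ {x z} → Star.Star R x z →
                    ∃ λ vs → Path R x z vs × Unique vs
  Star⇒simplePath _≟A_ ε = _ , end , [] ∷ []
  Star⇒simplePath _≟A_ {x} (r ◅ walk) with Star⇒simplePath _≟A_ walk
  ... | vs , path , unique with x ∈? vs
    where open DecMembership _≟A_ using (_∈?_)
  ... | yes x∈vs = Path-suffix path unique x∈vs
  ... | no  x∉vs = _ , step r path , ¬Any⇒All¬ vs x∉vs ∷ unique

  close-Path : ∀ {S : A → A → Set} {x z w vs} → (∀ {u v} → R u v → S u v) →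
               Path R x z vs → S z w → Linked S (vs ++ [ w ])
  close-Path f end                     s = s ∷ [-]
  close-Path f (step r end)            s = f r ∷ close-Path f end s
  close-Path f (step r (step r′ path)) s = f r ∷ close-Path f (step r′ path) s

Reach⇒Cycle : {a b : Fin n} {E : List (Edge n)} →
              SimpleEdges ((a , b) ∷ E) → Reach E a b → Cycle ((a , b) ∷ E)
Reach⇒Cycle {a = a} {b} {E} (a<b ∷ ordered , ab∉E ∷ _) a⇝b with Star⇒simplePath _≟_ a⇝b
... | _ , end , _ = ⊥-elim (FinP.<-irrefl refl a<b)
... | _ , step a~b end , _ = contradiction a~b not-adjacent
  where
  not-adjacent : ¬ Adj E a b
  not-adjacent (inj₁ ab∈E) = All.lookup ab∉E ab∈E refl
  not-adjacent (inj₂ ba∈E) = FinP.<-asym a<b (All.lookup ordered ba∈E)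
... | _ , path@(step _ (step _ rest)) , unique =
  a , _ , unique , s≤s (s≤s (Path-nonempty rest)) ,
  close-Path (Adj-mono (xs⊆x∷xs E (a , b))) path (inj₂ (here refl))

edgesIn : (Fin n → Fin n) → List (Edge n) → Fin n → ℕ
edgesIn label E r = count (label ∘ proj₁) r E

verticesIn : (Fin n → Fin n) → Fin n → ℕ
verticesIn {n} label r = count label r (allFin n)

record ComponentLabelling {n} (E : List (Edge n)) : Set where
  field
    label          : Fin n → Fin n
    label≡⇒Reach   : ∀ {u v} → label u ≡ label v → Reach E u v
    edges<vertices : ∀ r → edgesIn label E r ≡ 0 ⊎ edgesIn label E r < verticesIn label r

  occupied : ∀ v → edgesIn label E (label v) < verticesIn label (label v)
  occupied v with edges<vertices (label v)
  ... | inj₁ none  = subst (_< _) (sym none) (count-∈ label (∈-allFin v))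
  ... | inj₂ fewer = fewer

addEdge : {a b : Fin n} {E : List (Edge n)} (L : ComponentLabelling E) →
          ComponentLabelling.label L a ≢ ComponentLabelling.label L b →
          ComponentLabelling ((a , b) ∷ E)
addEdge {n} {a} {b} {E} L la≢lb = record
  { label = label′ ; label≡⇒Reach = label′≡⇒Reach ; edges<vertices = edges<vertices′ }
  where
  open ComponentLabelling L
  la = label a
  lb = label b
  label′ = merge la lb ∘ label
  E′ = (a , b) ∷ E

  lift : ∀ {u v} → Reach E u v → Reach E′ u v
  lift = Reach-mono (xs⊆x∷xs E (a , b))

  label′≡⇒Reach : ∀ {u v} → label′ u ≡ label′ v → Reach E′ u v
  label′≡⇒Reach eq with merge-≡ eq
  ... | inj₁ lu≡lv                 = lift (label≡⇒Reach lu≡lv)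
  ... | inj₂ (inj₁ (lu≡la , lv≡lb)) =
    lift (label≡⇒Reach lu≡la) ◅◅ inj₁ (here refl) ◅ lift (label≡⇒Reach (sym lv≡lb))
  ... | inj₂ (inj₂ (lu≡lb , lv≡la)) =
    lift (label≡⇒Reach lu≡lb) ◅◅ inj₂ (here refl) ◅ lift (label≡⇒Reach (sym lv≡la))

  edgesIn′ : ∀ r → edgesIn label′ E′ r ≡ δ la r + edgesIn label′ E r
  edgesIn′ r = trans (count-∷ (label′ ∘ proj₁) r (a , b) E)
                     (cong (λ y → δ y r + edgesIn label′ E r) (merge-≢ la≢lb))

  edges<vertices′ : ∀ r → edgesIn label′ E′ r ≡ 0 ⊎ edgesIn label′ E′ r < verticesIn label′ r
  edges<vertices′ r with r ≟ la | r ≟ lb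
  ... | yes refl | _ = inj₂ (begin
    suc (edgesIn label′ E′ la)
      ≡⟨ cong suc (edgesIn′ la) ⟩
    suc (δ la la + edgesIn label′ E la)
      ≡⟨ cong₂ (λ x y → suc (x + y)) (δ-refl la) (count-merge-a la≢lb (label ∘ proj₁) E) ⟩
    suc (suc (edgesIn label E la + edgesIn label E lb))
      ≡⟨ cong suc (+-suc _ _) ⟨
    suc (edgesIn label E la) + suc (edgesIn label E lb)
      ≤⟨ +-mono-≤ (occupied a) (occupied b) ⟩
    verticesIn label la + verticesIn label lb
      ≡⟨ count-merge-a la≢lb label (allFin n) ⟨
    verticesIn label′ la
      ∎)
    where open ≤-Reasoning
  ... | no _ | yes refl =
    inj₁ (trans (edgesIn′ lb) (cong₂ _+_ (δ-≢ la≢lb) (count-merge-b la≢lb (label ∘ proj₁) E)))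
  ... | no r≢la | no r≢lb =
    Sum.map (trans same-edges) (subst₂ _<_ (sym same-edges) (sym same-vertices)) (edges<vertices r)
    where
    same-edges : edgesIn label′ E′ r ≡ edgesIn label E r
    same-edges = trans (edgesIn′ r)
      (cong₂ _+_ (δ-≢ (r≢la ∘ sym)) (count-merge-other la≢lb r≢la r≢lb (label ∘ proj₁) E))
    same-vertices : verticesIn label′ r ≡ verticesIn label r
    same-vertices = count-merge-other la≢lb r≢la r≢lb label (allFin n)

componentLabelling : (E : List (Edge n)) → Forest E → ComponentLabelling E
componentLabelling []            _ = record
  { label = id ; label≡⇒Reach = λ { refl → ε } ; edges<vertices = λ _ → inj₁ refl }
componentLabelling ((a , b) ∷ E) (simple@(_ ∷ ordered , _ ∷ unique) , acyclic) =
  addEdge L (λ la≡lb → acyclic (Reach⇒Cycle simple (label≡⇒Reach la≡lb)))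
  where
  L = componentLabelling E ((ordered , unique) , acyclic ∘ Cycle-mono (xs⊆x∷xs E (a , b)))
  open ComponentLabelling L

sameLabel⇒Tree : {E : List (Edge n)} (L : ComponentLabelling E) {r : Fin n} {p : ℕ}
                 (T : List (Edge n)) → Unique T → T ⊆ E →
                 All (λ e → ComponentLabelling.label L (proj₁ e) ≡ r) T →
                 suc p ≤ length T → HasTreeWithAtLeast (suc p) E
sameLabel⇒Tree L (e ∷ T) unique T⊆E same big =
  proj₁ e , e ∷ T , unique , T⊆E ,
  All.map (λ l≡r → label≡⇒Reach (trans (All.head same) (sym l≡r))) same , big
  where open ComponentLabelling L

small-class-bound : ∀ q {c v} → c ≤ q → c ≡ 0 ⊎ c < v → suc q * c ≤ q * v
small-class-bound q c≤q (inj₁ refl) = ≤-trans (≤-reflexive (*-zeroʳ (suc q))) z≤n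
small-class-bound q {c} {v} c≤q (inj₂ c<v) = begin
  suc q * c  ≤⟨ +-monoˡ-≤ (q * c) c≤q ⟩
  q + q * c  ≡⟨ *-suc q c ⟨
  q * suc c  ≤⟨ *-monoʳ-≤ q c<v ⟩
  q * v      ∎
  where open ≤-Reasoning

HasTreeWithAtLeast⊎edges≤ : ∀ q (E : List (Edge n)) → Forest E →
                            HasTreeWithAtLeast (suc q) E ⊎ length E * suc q ≤ n * q
HasTreeWithAtLeast⊎edges≤ {n} q E forest =
  Sum.map bigClass⇒Tree (small-classes⇒edges≤ ∘ small)
          (toSum (FinP.any? (λ r → suc q ≤? edgesIn label E r)))
  where
  L = componentLabelling E forest
  open ComponentLabelling L

  bigClass⇒Tree : (∃ λ r → suc q ≤ edgesIn label E r) → HasTreeWithAtLeast (suc q) E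
  bigClass⇒Tree (r , big) =
    sameLabel⇒Tree L (filter sameLabel? E) (Unique.filter⁺ sameLabel? (proj₂ (proj₁ forest)))
      (proj₁ ∘ ∈-filter⁻ sameLabel?) (all-filter sameLabel? E) big
    where
    sameLabel? = λ (e : Edge n) → label (proj₁ e) ≟ r

  small : ¬ (∃ λ r → suc q ≤ edgesIn label E r) → ∀ r → edgesIn label E r ≤ q
  small noBigClass r = ≤-pred (≰⇒> (λ big → noBigClass (r , big)))

  small-classes⇒edges≤ : (∀ r → edgesIn label E r ≤ q) → length E * suc q ≤ n * q
  small-classes⇒edges≤ few = begin
    length E * suc q                        ≡⟨ *-comm (length E) (suc q) ⟩
    suc q * length E                        ≡⟨ cong (suc q *_) (∑-count (label ∘ proj₁) E) ⟨
    suc q * ∑[ r < n ] edgesIn label E r    ≡⟨ *-distribˡ-sum (suc q) (edgesIn label E) ⟩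
    ∑[ r < n ] (suc q * edgesIn label E r)
      ≤⟨ ∑-mono-≤ (λ r → small-class-bound q (few r) (edges<vertices r)) ⟩
    ∑[ r < n ] (q * verticesIn label r)     ≡⟨ *-distribˡ-sum q (verticesIn label) ⟨
    q * ∑[ r < n ] verticesIn label r       ≡⟨ cong (q *_) (∑-count label (allFin n)) ⟩
    q * length (allFin n)                   ≡⟨ cong (q *_) (length-tabulate id) ⟩
    q * n                                   ≡⟨ *-comm q n ⟩
    n * q                                   ∎
    where open ≤-Reasoning

a₀≡aᵢ+i*p : ∀ {p l} (a : ℕ → ℕ) → (∀ i → i < l → a (suc i) + p ≡ a i) →
            ∀ i → i ≤ l → a 0 ≡ a i + i * p
a₀≡aᵢ+i*p a decreases zero    _     = sym (+-identityʳ (a 0))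
a₀≡aᵢ+i*p {p} a decreases (suc i) i<l = begin
  a 0                      ≡⟨ a₀≡aᵢ+i*p a decreases i (<⇒≤ i<l) ⟩
  a i + i * p              ≡⟨ cong (_+ i * p) (decreases i i<l) ⟨
  (a (suc i) + p) + i * p  ≡⟨ +-assoc (a (suc i)) p (i * p) ⟩
  a (suc i) + suc i * p    ∎
  where open ≡-Reasoning

ceilDiv-least : ∀ {a d l} → a ≤ l * d → ceilDiv a d ≤ l
ceilDiv-least {d = zero}          _     = z≤n
ceilDiv-least {a} {suc k} {l} a≤l*d = ≤-pred (m<n*o⇒m/o<n (begin-strict
  a + k              ≤⟨ +-monoˡ-≤ k a≤l*d ⟩
  l * suc k + k      <⟨ +-monoʳ-< (l * suc k) (n<1+n k) ⟩
  l * suc k + suc k  ≡⟨ +-comm (l * suc k) (suc k) ⟩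
  suc l * suc k      ∎))
  where open ≤-Reasoning

lemma1 : (n p l : ℕ) (F : ℕ → List (Edge n)) →
    1 ≤ p → p ≤ n ∸ 1 → 1 ≤ l →
    (∀ i → i ≤ l → Forest (F i)) →
    (∀ i → i < l → F (suc i) ⊆ F i × length (F (suc i)) + p ≡ length (F i)) →
    ¬ HasTreeWithAtLeast p (F l) →
    n * (p ∸ 1) < length (F 0) * p →
    HasTreeWithAtLeast p (F 0)
    × (∀ i → i ≤ l → i * (p * p) + n * (p ∸ 1) < length (F 0) * p → HasTreeWithAtLeast p (F i))
    × l ≥ ceilDiv (length (F 0) * p ∸ n * (p ∸ 1)) (p * p)
lemma1 n (suc q) l F _ _ _ forest shrink noTree many = large 0 z≤n many , large , few
  where
  p = suc q

  shrinks-by-p : ∀ i → i < l → length (F (suc i)) + p ≡ length (F i)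
  shrinks-by-p i i<l = proj₂ (shrink i i<l)

  tree⊎bound : ∀ i → i ≤ l →
               HasTreeWithAtLeast p (F i) ⊎ length (F 0) * p ≤ n * q + i * (p * p)
  tree⊎bound i i≤l = Sum.map₂ shift (HasTreeWithAtLeast⊎edges≤ q (F i) (forest i i≤l))
    where
    open ≤-Reasoning
    shift : length (F i) * p ≤ n * q → length (F 0) * p ≤ n * q + i * (p * p)
    shift edges≤ = begin
      length (F 0) * p                ≡⟨ cong (_* p) (a₀≡aᵢ+i*p (length ∘ F) shrinks-by-p i i≤l) ⟩
      (length (F i) + i * p) * p      ≡⟨ *-distribʳ-+ p (length (F i)) (i * p) ⟩
      length (F i) * p + i * p * p    ≡⟨ cong (length (F i) * p +_) (*-assoc i p p) ⟩
      length (F i) * p + i * (p * p)  ≤⟨ +-monoˡ-≤ (i * (p * p)) edges≤ ⟩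
      n * q + i * (p * p)             ∎

  large : ∀ i → i ≤ l → i * (p * p) + n * q < length (F 0) * p → HasTreeWithAtLeast p (F i)
  large i i≤l many = [ id , ⊥-elim ∘ <⇒≱ many′ ]′ (tree⊎bound i i≤l)
    where
    many′ : n * q + i * (p * p) < length (F 0) * p
    many′ = subst (_< length (F 0) * p) (+-comm (i * (p * p)) (n * q)) many

  few : l ≥ ceilDiv (length (F 0) * p ∸ n * q) (p * p)
  few = [ ⊥-elim ∘ noTree , ceilDiv-least ∘ m≤n+o⇒m∸n≤o _ (n * q) ]′ (tree⊎bound l ≤-refl)
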